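{- Let $\Delta_d=\{\mathbf{0},e_1,\dots,e_d\}\subseteq\{0,1\}^d$ be the vertex set of the standard $d$-simplex ($e_i$ the unit vectors). Then every hiding set for $\Delta_d$ has cardinality at most $3$.
   Context: For $X\subseteq\mathbb{Z}^d$, a set $H\subseteq(\mathrm{aff}(X)\cap\mathbb{Z}^d)\setminus\mathrm{conv}(X)$ is a hiding set for $X$ if for any two distinct points $a,b\in H$ we have $\mathrm{conv}\{a,b\}\cap\mathrm{conv}(X)\neq\emptyset$. -}

module Defs where

open import Data.Nat using (ℕ; zero; suc)
open import Data.Integer using (ℤ; +_)
open import Data.Rational using (ℚ; 0ℚ; 1ℚ; _+_; _*_; _≤_; _/_)
open import Data.Fin using (Fin; zero; suc; _≟_)
open import Data.Vec using (Vec; []; _∷_; map; lookup; tabulate; replicate; zipWith)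
open import Data.Product using (Σ; _×_; ∃)
open import Relation.Binary.PropositionalEquality using (_≡_; _≢_)
open import Relation.Nullary using (¬_; yes; no)

Point : ℕ → Set
Point d = Vec ℤ d

QPoint : ℕ → Set
QPoint d = Vec ℚ d

toℚ : ℤ → ℚ
toℚ z = z / 1

embed : ∀ {d} → Point d → QPoint d
embed = map toℚ

sumFin : ∀ {m} → (Fin m → ℚ) → ℚ
sumFin {zero} f = 0ℚ
sumFin {suc m} f = f zero + sumFin (λ j → f (suc j))

lincomb : ∀ {d m} → (Fin m → ℚ) → Vec (QPoint d) m → QPoint d
lincomb {d} {zero} c [] = replicate d 0ℚ
lincomb {d} {suc m} c (p ∷ ps) =
  zipWith _+_ (map (c zero *_) p) (lincomb (λ j → c (suc j)) ps)

InConv : ∀ {d m} → Vec (QPoint d) m → QPoint d → Set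
InConv {d} {m} X x = Σ (Fin m → ℚ) λ c →
  ((j : Fin m) → 0ℚ ≤ c j) × (sumFin c ≡ 1ℚ) × (x ≡ lincomb c X)

InAff : ∀ {d m} → Vec (QPoint d) m → QPoint d → Set
InAff {d} {m} X x = Σ (Fin m → ℚ) λ c → (sumFin c ≡ 1ℚ) × (x ≡ lincomb c X)

SegmentMeets : ∀ {d m} → Vec (QPoint d) m → QPoint d → QPoint d → Set
SegmentMeets {d} X a b = Σ (QPoint d) λ y → InConv (a ∷ b ∷ []) y × InConv X y

HidingSet : ∀ {d m} → Vec (Point d) m → (Point d → Set) → Set
HidingSet {d} X H =
  ((h : Point d) → H h → InAff (map embed X) (embed h) × ¬ InConv (map embed X) (embed h))
  × ((a b : Point d) → H a → H b → a ≢ b → SegmentMeets (map embed X) (embed a) (embed b))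

unitVec : ∀ {d} → Fin d → Point d
unitVec i = tabulate λ j → ite (i ≟ j)
  where
  ite : ∀ {P : Set} → Relation.Nullary.Dec P → ℤ
  ite (yes _) = + 1
  ite (no _) = + 0

Δ : (d : ℕ) → Vec (Point d) (suc d)
Δ d = replicate d (+ 0) ∷ tabulate unitVec

module Submission where

-- Use barycentric coordinates with respect to Δ_d: for x ∈ ℚ^d put
-- λ₀(x) = 1 - Σ x_i and λ_{i+1}(x) = x_i.  They always sum to 1, they are affine
-- (λ of a convex combination is the convex combination of the λ's), and x ∈ conv Δ_d
-- iff all λ_j(x) ≥ 0.  For an integer point every λ_j is an integer, hence ≤ 0 or ≥ 1.
--
-- Let a, b be distinct points of a hiding set H and y ∈ [a,b] ∩ conv Δ_d.
--  (1) If λ_j(a) < 0 then λ_j(b) ≥ 1: otherwise λ_j(b) ≤ 0 forces y = b ∈ conv Δ_d.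
--  (2) If λ_j(a), λ_j(b), λ_k(a), λ_k(b) ≥ 1 for j ≠ k then λ_j(y) + λ_k(y) ≥ 2 > 1.
-- Given four distinct points a, b, c, e ∈ H, pick negative coordinates j of c and k of e
-- (they exist since c, e ∉ conv Δ_d).  By (1) j ≠ k, and a, b have λ_j, λ_k ≥ 1;
-- so (2) applied to the segment [a,b] is a contradiction.

module SimplexHiding where
  open import Defs
  open import Data.Nat using (ℕ; zero; suc; s≤s; z≤n)
  open import Data.Integer as ℤ using (ℤ; -[1+_])
  import Data.Integer.Properties as ℤP
  open import Data.Rational as ℚ using (ℚ; mkℚ; 0ℚ; 1ℚ; _+_; _*_; _-_; _≤_; _<_)
  import Data.Rational.Properties as ℚP
  open import Data.Rational.Solver using (module +-*-Solver)
  open +-*-Solver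
  open import Data.Nat.Coprimality using (1-coprimeTo) renaming (sym to coprime-sym)
  open import Data.Fin using (Fin; zero; suc; _≟_)
  import Data.Fin.Properties as FinP
  open import Data.Vec as V using (Vec; []; _∷_; lookup; tabulate; replicate)
  import Data.Vec.Properties as VecP
  open import Data.Product using (Σ; _,_; proj₁; proj₂)
  open import Data.Sum using (_⊎_; inj₁; inj₂)
  open import Data.Empty using (⊥; ⊥-elim)
  open import Relation.Nullary using (¬_; yes; no)
  open import Relation.Nullary.Decidable using (toWitnessFalse)
  open import Relation.Binary.PropositionalEquality
  open ≡-Reasoning

  sumFin-cong : ∀ {m} {f g : Fin m → ℚ} → (∀ j → f j ≡ g j) → sumFin f ≡ sumFin g
  sumFin-cong {zero} e = refl
  sumFin-cong {suc m} e = cong₂ _+_ (e zero) (sumFin-cong (λ j → e (suc j)))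

  sumFin-zero : ∀ {m} (f : Fin m → ℚ) → (∀ j → f j ≡ 0ℚ) → sumFin f ≡ 0ℚ
  sumFin-zero {zero} f e = refl
  sumFin-zero {suc m} f e =
    cong₂ _+_ (e zero) (sumFin-zero (λ j → f (suc j)) (λ j → e (suc j)))

  sumFin-+ : ∀ {m} (f g : Fin m → ℚ) → sumFin (λ j → f j + g j) ≡ sumFin f + sumFin g
  sumFin-+ {zero} f g = refl
  sumFin-+ {suc m} f g =
    trans (cong ((f zero + g zero) +_) (sumFin-+ (λ j → f (suc j)) (λ j → g (suc j))))
          (solve 4 (λ a b F G → (a :+ b) :+ (F :+ G) := (a :+ F) :+ (b :+ G)) refl
                 (f zero) (g zero) (sumFin (λ j → f (suc j))) (sumFin (λ j → g (suc j))))

  sumFin-scale : ∀ {m} (p : ℚ) (f : Fin m → ℚ) → sumFin (λ j → p * f j) ≡ p * sumFin f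
  sumFin-scale {zero} p f = sym (ℚP.*-zeroʳ p)
  sumFin-scale {suc m} p f =
    trans (cong (p * f zero +_) (sumFin-scale p (λ j → f (suc j))))
          (sym (ℚP.*-distribˡ-+ p (f zero) (sumFin (λ j → f (suc j)))))

  sumFin-sub : ∀ {m} (f g : Fin m → ℚ) → sumFin f - sumFin g ≡ sumFin (λ j → f j - g j)
  sumFin-sub {zero} f g = refl
  sumFin-sub {suc m} f g =
    trans (solve 4 (λ a b F G → (a :+ F) :- (b :+ G) := (a :- b) :+ (F :- G)) refl
                 (f zero) (g zero) (sumFin (λ j → f (suc j))) (sumFin (λ j → g (suc j))))
          (cong ((f zero - g zero) +_) (sumFin-sub (λ j → f (suc j)) (λ j → g (suc j))))

  sumFin-swap : ∀ {m n} (f : Fin m → Fin n → ℚ) →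
    sumFin (λ i → sumFin (f i)) ≡ sumFin (λ k → sumFin (λ i → f i k))
  sumFin-swap {zero} {n} f = sym (sumFin-zero {n} _ (λ k → refl))
  sumFin-swap {suc m} f =
    trans (cong (sumFin (f zero) +_) (sumFin-swap (λ i → f (suc i))))
          (sym (sumFin-+ (f zero) (λ k → sumFin (λ i → f (suc i) k))))

  ≤-+-nonnegʳ : ∀ x {y} → 0ℚ ≤ y → x ≤ x + y
  ≤-+-nonnegʳ x {y} 0≤y = subst (_≤ x + y) (ℚP.+-identityʳ x) (ℚP.+-monoʳ-≤ x 0≤y)

  ≤-+-nonnegˡ : ∀ {x} y → 0ℚ ≤ x → y ≤ x + y
  ≤-+-nonnegˡ {x} y 0≤x = subst (_≤ x + y) (ℚP.+-identityˡ y) (ℚP.+-monoˡ-≤ y 0≤x)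

  sumFin-nonneg : ∀ {m} (c : Fin m → ℚ) → (∀ j → 0ℚ ≤ c j) → 0ℚ ≤ sumFin c
  sumFin-nonneg {zero} c nn = ℚP.≤-refl
  sumFin-nonneg {suc m} c nn =
    ℚP.+-mono-≤ (nn zero) (sumFin-nonneg (λ j → c (suc j)) (λ j → nn (suc j)))

  term≤sumFin : ∀ {m} (c : Fin m → ℚ) → (∀ j → 0ℚ ≤ c j) → ∀ j → c j ≤ sumFin c
  term≤sumFin {suc m} c nn zero =
    ≤-+-nonnegʳ (c zero) (sumFin-nonneg (λ j → c (suc j)) (λ j → nn (suc j)))
  term≤sumFin {suc m} c nn (suc j) =
    ℚP.≤-trans (term≤sumFin (λ j → c (suc j)) (λ j → nn (suc j)) j) (≤-+-nonnegˡ _ (nn zero))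

  pair≤sumFin : ∀ {m} (c : Fin m → ℚ) → (∀ j → 0ℚ ≤ c j) →
    ∀ j k → j ≢ k → c j + c k ≤ sumFin c
  pair≤sumFin {suc m} c nn zero zero j≢k = ⊥-elim (j≢k refl)
  pair≤sumFin {suc m} c nn zero (suc k) _ =
    ℚP.+-monoʳ-≤ (c zero) (term≤sumFin (λ j → c (suc j)) (λ j → nn (suc j)) k)
  pair≤sumFin {suc m} c nn (suc j) zero _ =
    subst (_≤ sumFin c) (ℚP.+-comm (c zero) (c (suc j)))
      (ℚP.+-monoʳ-≤ (c zero) (term≤sumFin (λ j → c (suc j)) (λ j → nn (suc j)) j))
  pair≤sumFin {suc m} c nn (suc j) (suc k) sj≢sk =
    ℚP.≤-trans (pair≤sumFin (λ j → c (suc j)) (λ j → nn (suc j)) j k (λ j≡k → sj≢sk (cong suc j≡k)))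
               (≤-+-nonnegˡ _ (nn zero))

  toℚ-mkℚ : ∀ z → toℚ z ≡ mkℚ z 0 (coprime-sym (1-coprimeTo _))
  toℚ-mkℚ z = ℚP.↥p/↧p≡p (mkℚ z 0 (coprime-sym (1-coprimeTo _)))

  toℚ-+ : ∀ z w → toℚ z + toℚ w ≡ toℚ (z ℤ.+ w)
  toℚ-+ z w rewrite toℚ-mkℚ z | toℚ-mkℚ w =
    ℚP./-cong {p₁ = z ℤ.* ℤ.+ 1 ℤ.+ w ℤ.* ℤ.+ 1} {q₁ = 1}
      (cong₂ ℤ._+_ (ℤP.*-identityʳ z) (ℤP.*-identityʳ w)) refl

  toℚ-neg : ∀ z → ℚ.- toℚ z ≡ toℚ (ℤ.- z)
  toℚ-neg z rewrite toℚ-mkℚ z | toℚ-mkℚ (ℤ.- z) with z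
  ... | ℤ.+ zero = refl
  ... | ℤ.+ suc n = refl
  ... | -[1+ n ] = refl

  toℚ-mono : ∀ {z w} → z ℤ.≤ w → toℚ z ≤ toℚ w
  toℚ-mono {z} {w} z≤w rewrite toℚ-mkℚ z | toℚ-mkℚ w =
    ℚ.*≤* (subst₂ ℤ._≤_ (sym (ℤP.*-identityʳ z)) (sym (ℤP.*-identityʳ w)) z≤w)

  IsInteger : ℚ → Set
  IsInteger q = Σ ℤ λ z → q ≡ toℚ z

  sumFin-integer : ∀ {m} (f : Fin m → ℚ) → (∀ j → IsInteger (f j)) → IsInteger (sumFin f)
  sumFin-integer {zero} f int = ℤ.+ 0 , refl
  sumFin-integer {suc m} f int with int zero | sumFin-integer (λ j → f (suc j)) (λ j → int (suc j))
  ... | z , f₀≡z | w , rest≡w = z ℤ.+ w , trans (cong₂ _+_ f₀≡z rest≡w) (toℚ-+ z w)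

  Gap : ℚ → Set
  Gap q = q ≤ 0ℚ ⊎ 1ℚ ≤ q

  integer-gap : ∀ {q} → IsInteger q → Gap q
  integer-gap (ℤ.+ zero , refl) = inj₁ ℚP.≤-refl
  integer-gap (ℤ.+ suc n , refl) = inj₂ (toℚ-mono {ℤ.+ 1} {ℤ.+ suc n} (ℤ.+≤+ (s≤s z≤n)))
  integer-gap (-[1+ n ] , refl) = inj₁ (toℚ-mono { -[1+ n ]} {ℤ.+ 0} ℤ.-≤+)

  bary : ∀ {d} → QPoint d → Fin (suc d) → ℚ
  bary x zero = 1ℚ - sumFin (lookup x)
  bary x (suc i) = lookup x i

  bary-sum : ∀ {d} (x : QPoint d) → sumFin (bary x) ≡ 1ℚ
  bary-sum x = solve 1 (λ S → (con 1ℚ :- S) :+ S := con 1ℚ) refl (sumFin (lookup x))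

  lookup-lincomb : ∀ {d m} (c : Fin m → ℚ) (Y : Vec (QPoint d) m) (i : Fin d) →
    lookup (lincomb c Y) i ≡ sumFin (λ k → c k * lookup (lookup Y k) i)
  lookup-lincomb {d} {zero} c [] i = VecP.lookup-replicate i 0ℚ
  lookup-lincomb {d} {suc m} c (p ∷ ps) i =
    trans (VecP.lookup-zipWith _+_ i (V.map (c zero *_) p) (lincomb (λ k → c (suc k)) ps))
          (cong₂ _+_ (VecP.lookup-map i (c zero *_) p) (lookup-lincomb (λ k → c (suc k)) ps i))

  bary-affine : ∀ {d m} (c : Fin m → ℚ) (Y : Vec (QPoint d) m) → sumFin c ≡ 1ℚ →
    ∀ j → bary (lincomb c Y) j ≡ sumFin (λ k → c k * bary (lookup Y k) j)
  bary-affine c Y Σc≡1 (suc i) = lookup-lincomb c Y i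
  bary-affine {d} {m} c Y Σc≡1 zero = begin
    1ℚ - sumFin (lookup (lincomb c Y))
      ≡⟨ cong (1ℚ -_) (sumFin-cong (lookup-lincomb c Y)) ⟩
    1ℚ - sumFin (λ i → sumFin (λ k → c k * lookup (lookup Y k) i))
      ≡⟨ cong (1ℚ -_) (sumFin-swap (λ i k → c k * lookup (lookup Y k) i)) ⟩
    1ℚ - sumFin (λ k → sumFin (λ i → c k * lookup (lookup Y k) i))
      ≡⟨ cong (1ℚ -_) (sumFin-cong (λ k → sumFin-scale (c k) (lookup (lookup Y k)))) ⟩
    1ℚ - sumFin (λ k → c k * S k)
      ≡⟨ cong (_- sumFin (λ k → c k * S k)) (sym Σc≡1) ⟩
    sumFin c - sumFin (λ k → c k * S k)
      ≡⟨ sumFin-sub c (λ k → c k * S k) ⟩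
    sumFin (λ k → c k - c k * S k)
      ≡⟨ sumFin-cong (λ k → solve 2 (λ a b → a :- a :* b := a :* (con 1ℚ :- b)) refl (c k) (S k)) ⟩
    sumFin (λ k → c k * (1ℚ - S k))
      ∎
    where
    S : Fin m → ℚ
    S k = sumFin (lookup (lookup Y k))

  kronecker : ∀ {n} → Fin n → Fin n → ℚ
  kronecker zero zero = 1ℚ
  kronecker zero (suc j) = 0ℚ
  kronecker (suc k) zero = 0ℚ
  kronecker (suc k) (suc j) = kronecker k j

  kronecker-diag : ∀ {n} (k : Fin n) → kronecker k k ≡ 1ℚ
  kronecker-diag zero = refl
  kronecker-diag (suc k) = kronecker-diag k

  kronecker-off : ∀ {n} (k j : Fin n) → k ≢ j → kronecker k j ≡ 0ℚ
  kronecker-off zero zero k≢j = ⊥-elim (k≢j refl)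
  kronecker-off zero (suc j) _ = refl
  kronecker-off (suc k) zero _ = refl
  kronecker-off (suc k) (suc j) sk≢sj = kronecker-off k j (λ k≡j → sk≢sj (cong suc k≡j))

  sumFin-kronecker : ∀ {n} (k : Fin n) → sumFin (kronecker k) ≡ 1ℚ
  sumFin-kronecker {suc n} zero = cong (1ℚ +_) (sumFin-zero {n} (λ j → kronecker zero (suc j)) (λ j → refl))
  sumFin-kronecker (suc k) = trans (ℚP.+-identityˡ _) (sumFin-kronecker k)

  sumFin-select : ∀ {n} (c : Fin n → ℚ) (j : Fin n) → sumFin (λ k → c k * kronecker k j) ≡ c j
  sumFin-select c zero =
    trans (cong₂ _+_ (ℚP.*-identityʳ (c zero))
                     (sumFin-zero (λ k → c (suc k) * 0ℚ) (λ k → ℚP.*-zeroʳ (c (suc k)))))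
          (ℚP.+-identityʳ (c zero))
  sumFin-select c (suc j) =
    trans (cong₂ _+_ (ℚP.*-zeroʳ (c zero)) (sumFin-select (λ k → c (suc k)) j))
          (ℚP.+-identityˡ (c (suc j)))

  lookup-tabulated : ∀ {n} {f : Fin n → ℤ} {v : Vec ℤ n} → v ≡ tabulate f → ∀ j → lookup v j ≡ f j
  lookup-tabulated refl j = VecP.lookup∘tabulate _ j

  unitVec-coord : ∀ {d} (k i : Fin d) → toℚ (lookup (unitVec k) i) ≡ kronecker k i
  unitVec-coord k i rewrite lookup-tabulated {v = unitVec k} refl i with k ≟ i
  ... | yes refl = sym (kronecker-diag k)
  ... | no k≢i = sym (kronecker-off k i k≢i)

  simplex : (d : ℕ) → Vec (QPoint d) (suc d)
  simplex d = V.map embed (Δ d)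

  origin-coord : ∀ {d} (i : Fin d) → lookup (lookup (simplex d) zero) i ≡ 0ℚ
  origin-coord {d} i =
    trans (VecP.lookup-map i toℚ (replicate d (ℤ.+ 0))) (cong toℚ (VecP.lookup-replicate i (ℤ.+ 0)))

  unit-coord : ∀ {d} (k i : Fin d) → lookup (lookup (simplex d) (suc k)) i ≡ kronecker k i
  unit-coord {d} k i =
    trans (cong (λ v → lookup v i) (trans (VecP.lookup-map k embed (tabulate unitVec))
                                          (cong embed (VecP.lookup∘tabulate unitVec k))))
          (trans (VecP.lookup-map i toℚ (unitVec k)) (unitVec-coord k i))

  bary-vertex : ∀ {d} (k j : Fin (suc d)) → bary (lookup (simplex d) k) j ≡ kronecker k j
  bary-vertex {d} zero zero = cong (1ℚ -_) (sumFin-zero {d} _ origin-coord)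
  bary-vertex zero (suc i) = origin-coord i
  bary-vertex (suc k) zero =
    cong (1ℚ -_) (trans (sumFin-cong (unit-coord k)) (sumFin-kronecker k))
  bary-vertex (suc k) (suc i) = unit-coord k i

  bary-combination : ∀ {d} (c : Fin (suc d) → ℚ) → sumFin c ≡ 1ℚ →
    ∀ j → bary (lincomb c (simplex d)) j ≡ c j
  bary-combination c Σc≡1 j =
    trans (bary-affine c (simplex _) Σc≡1 j)
          (trans (sumFin-cong (λ k → cong (c k *_) (bary-vertex k j))) (sumFin-select c j))

  vec-ext : ∀ {n} (x y : QPoint n) → (∀ i → lookup x i ≡ lookup y i) → x ≡ y
  vec-ext x y e = trans (sym (VecP.tabulate∘lookup x)) (trans (VecP.tabulate-cong e) (VecP.tabulate∘lookup y))

  conv⇒bary-nonneg : ∀ {d} {x : QPoint d} → InConv (simplex d) x → ∀ j → 0ℚ ≤ bary x j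
  conv⇒bary-nonneg (c , c≥0 , Σc≡1 , refl) j = subst (0ℚ ≤_) (sym (bary-combination c Σc≡1 j)) (c≥0 j)

  bary-nonneg⇒conv : ∀ {d} (x : QPoint d) → (∀ j → 0ℚ ≤ bary x j) → InConv (simplex d) x
  bary-nonneg⇒conv x bary≥0 = bary x , bary≥0 , bary-sum x ,
    vec-ext _ _ (λ i → sym (bary-combination (bary x) (bary-sum x) (suc i)))

  bary-integer : ∀ {d} (p : Point d) j → IsInteger (bary (embed p) j)
  bary-integer p (suc i) = lookup p i , VecP.lookup-map i toℚ p
  bary-integer p zero with sumFin-integer (lookup (embed p)) (λ i → bary-integer p (suc i))
  ... | z , Σ≡z = ℤ.+ 1 ℤ.- z , (begin
    1ℚ - sumFin (lookup (embed p))   ≡⟨ cong (1ℚ -_) Σ≡z ⟩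
    toℚ (ℤ.+ 1) + ℚ.- toℚ z          ≡⟨ cong (toℚ (ℤ.+ 1) +_) (toℚ-neg z) ⟩
    toℚ (ℤ.+ 1) + toℚ (ℤ.- z)        ≡⟨ toℚ-+ (ℤ.+ 1) (ℤ.- z) ⟩
    toℚ (ℤ.+ 1 ℤ.- z)                ∎)

  combination-negative : ∀ {s t A B} → 0ℚ < s → A < 0ℚ → 0ℚ ≤ t → B ≤ 0ℚ → s * A + t * B < 0ℚ
  combination-negative {s} {t} s>0 A<0 t≥0 B≤0 =
    ℚP.+-mono-<-≤ (subst (s * _ <_) (ℚP.*-zeroʳ s) (ℚP.*-monoʳ-<-pos s {{ℚ.positive s>0}} A<0))
                  (subst (t * _ ≤_) (ℚP.*-zeroʳ t) (ℚP.*-monoˡ-≤-nonNeg t {{ℚ.nonNegative t≥0}} B≤0))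

  combination-≥1 : ∀ {s t A B} → 0ℚ ≤ s → 0ℚ ≤ t → s + t ≡ 1ℚ → 1ℚ ≤ A → 1ℚ ≤ B → 1ℚ ≤ s * A + t * B
  combination-≥1 {s} {t} s≥0 t≥0 s+t≡1 A≥1 B≥1 =
    subst (_≤ s * _ + t * _) (trans (cong₂ _+_ (ℚP.*-identityʳ s) (ℚP.*-identityʳ t)) s+t≡1)
      (ℚP.+-mono-≤ (ℚP.*-monoˡ-≤-nonNeg s {{ℚ.nonNegative s≥0}} A≥1)
                   (ℚP.*-monoˡ-≤-nonNeg t {{ℚ.nonNegative t≥0}} B≥1))

  record Crossing {d} (a b : QPoint d) : Set where
    field
      s t : ℚ
      s≥0 : 0ℚ ≤ s
      t≥0 : 0ℚ ≤ t
      s+t≡1 : s + t ≡ 1ℚ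
      point : QPoint d
      point-bary : ∀ j → bary point j ≡ s * bary a j + t * bary b j
      point-inside : ∀ j → 0ℚ ≤ bary point j

  crossing : ∀ {d} {a b : QPoint d} → SegmentMeets (simplex d) a b → Crossing a b
  crossing {a = a} {b} (y , (c , c≥0 , Σc≡1 , refl) , y∈conv) = record
    { s = c zero
    ; t = c (suc zero)
    ; s≥0 = c≥0 zero
    ; t≥0 = c≥0 (suc zero)
    ; s+t≡1 = trans (cong (c zero +_) (sym (ℚP.+-identityʳ (c (suc zero))))) Σc≡1
    ; point = y
    ; point-bary = λ j → trans (bary-affine c (a ∷ b ∷ []) Σc≡1 j)
                                (cong (c zero * bary a j +_) (ℚP.+-identityʳ _))
    ; point-inside = conv⇒bary-nonneg y∈conv
    }

  -- (1) if a is strictly beyond the facet λ_j = 0 and b is not strictly inside it,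
  -- the segment can only meet conv Δ_d at b; hence b ∈ conv Δ_d
  crossing-at-endpoint : ∀ {d} {a b : QPoint d} → Crossing a b →
    ∀ j → bary a j < 0ℚ → bary b j ≤ 0ℚ → ∀ k → 0ℚ ≤ bary b k
  crossing-at-endpoint {a = a} {b} X j a<0 b≤0 k = subst (0ℚ ≤_) point-at-b (point-inside k)
    where
    open Crossing X
    s≯0 : ¬ (0ℚ < s)
    s≯0 s>0 = ℚP.<-irrefl refl (ℚP.≤-<-trans
      (subst (0ℚ ≤_) (point-bary j) (point-inside j)) (combination-negative s>0 a<0 t≥0 b≤0))
    s≡0 : s ≡ 0ℚ
    s≡0 = ℚP.≤-antisym (ℚP.≮⇒≥ s≯0) s≥0
    t≡1 : t ≡ 1ℚ
    t≡1 = trans (sym (ℚP.+-identityˡ t)) (trans (cong (_+ t) (sym s≡0)) s+t≡1)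
    point-at-b : bary point k ≡ bary b k
    point-at-b = begin
      bary point k                       ≡⟨ point-bary k ⟩
      s * bary a k + t * bary b k        ≡⟨ cong₂ (λ u v → u * bary a k + v * bary b k) s≡0 t≡1 ⟩
      0ℚ * bary a k + 1ℚ * bary b k      ≡⟨ solve 2 (λ A B → con 0ℚ :* A :+ con 1ℚ :* B := B) refl (bary a k) (bary b k) ⟩
      bary b k                           ∎

  two≰one : ¬ (1ℚ + 1ℚ ≤ 1ℚ)
  two≰one = toWitnessFalse {a? = (1ℚ + 1ℚ) ℚ.≤? 1ℚ} _

  -- (2) the segment between two points that are both at least 1 on two different
  -- coordinates λ_j, λ_k cannot meet conv Δ_d, where λ_j + λ_k ≤ 1
  crossing-two-facets : ∀ {d} {a b : QPoint d} → Crossing a b → ∀ {j k} → j ≢ k →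
    1ℚ ≤ bary a j → 1ℚ ≤ bary b j → 1ℚ ≤ bary a k → 1ℚ ≤ bary b k → ⊥
  crossing-two-facets {a = a} {b} X {j} {k} j≢k aj≥1 bj≥1 ak≥1 bk≥1 =
    two≰one (ℚP.≤-trans (ℚP.+-mono-≤ (far j aj≥1 bj≥1) (far k ak≥1 bk≥1))
                        (subst (bary point j + bary point k ≤_) (bary-sum point)
                               (pair≤sumFin (bary point) point-inside j k j≢k)))
    where
    open Crossing X
    far : ∀ i → 1ℚ ≤ bary a i → 1ℚ ≤ bary b i → 1ℚ ≤ bary point i
    far i ai≥1 bi≥1 = subst (1ℚ ≤_) (sym (point-bary i)) (combination-≥1 s≥0 t≥0 s+t≡1 ai≥1 bi≥1)

  module _ {d : ℕ} (H : Point d → Set) (hid : HidingSet (Δ d) H) where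

    negative-coord : ∀ {p} → H p → Σ (Fin (suc d)) λ j → bary (embed p) j < 0ℚ
    negative-coord {p} hp = j , ℚP.≰⇒> λj≱0
      where
      not-all-nonneg : ¬ (∀ j → 0ℚ ≤ bary (embed p) j)
      not-all-nonneg bary≥0 = proj₂ (proj₁ hid p hp) (bary-nonneg⇒conv (embed p) bary≥0)
      witness : Σ (Fin (suc d)) λ j → ¬ (0ℚ ≤ bary (embed p) j)
      witness = FinP.¬∀⟶∃¬ (suc d) _ (λ j → 0ℚ ℚ.≤? bary (embed p) j) not-all-nonneg
      j : Fin (suc d)
      j = proj₁ witness
      λj≱0 : ¬ (0ℚ ≤ bary (embed p) j)
      λj≱0 = proj₂ witness

    -- (1) for hidden points: if λ_j(a) < 0 then λ_j(b) ≥ 1, as λ_j(b) is an integer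
    -- and λ_j(b) ≤ 0 would put b in conv Δ_d
    opposite-side : ∀ {a b} → H a → H b → a ≢ b → ∀ j → bary (embed a) j < 0ℚ → 1ℚ ≤ bary (embed b) j
    opposite-side {a} {b} ha hb a≢b j a<0 with integer-gap (bary-integer b j)
    ... | inj₂ b≥1 = b≥1
    ... | inj₁ b≤0 = ⊥-elim (proj₂ (proj₁ hid b hb) (bary-nonneg⇒conv _
                       (crossing-at-endpoint (crossing (proj₂ hid a b ha hb a≢b)) j a<0 b≤0)))

    no-four-hidden : ∀ {a b c e} → H a → H b → H c → H e →
      a ≢ b → a ≢ c → a ≢ e → b ≢ c → b ≢ e → c ≢ e → ⊥
    no-four-hidden {a} {b} {c} {e} ha hb hc he a≢b a≢c a≢e b≢c b≢e c≢e =
      crossing-two-facets (crossing (proj₂ hid a b ha hb a≢b)) {j} {k} j≢k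
        (opposite-side hc ha (≢-sym a≢c) j c<0) (opposite-side hc hb (≢-sym b≢c) j c<0)
        (opposite-side he ha (≢-sym a≢e) k e<0) (opposite-side he hb (≢-sym b≢e) k e<0)
      where
      j k : Fin (suc d)
      j = proj₁ (negative-coord hc)
      k = proj₁ (negative-coord he)
      c<0 : bary (embed c) j < 0ℚ
      c<0 = proj₂ (negative-coord hc)
      e<0 : bary (embed e) k < 0ℚ
      e<0 = proj₂ (negative-coord he)
      -- λ_j(e) ≥ 1 by (1), so j is not the negative coordinate k of e
      j≢k : j ≢ k
      j≢k j≡k = ℚP.<-irrefl refl (ℚP.≤-<-trans (opposite-side hc he c≢e j c<0)
        (subst (λ i → bary (embed e) i < 1ℚ) (sym j≡k) (ℚP.<-trans e<0 (ℚP.positive⁻¹ 1ℚ))))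

open import Defs
open import Data.Nat using (ℕ; _≤_; z≤n; s≤s)
open import Data.List using (List; length; []; _∷_)
open import Data.List.Relation.Unary.All using (All; []; _∷_)
open import Data.List.Relation.Unary.Unique.Propositional using (Unique)
open import Data.List.Relation.Unary.AllPairs using (_∷_)
open import Data.Empty using (⊥-elim)

proposition8 : (d : ℕ) (H : Point d → Set) → HidingSet (Δ d) H →
    (L : List (Point d)) → Unique L → All H L → length L ≤ 3
proposition8 d H hid [] _ _ = z≤n
proposition8 d H hid (_ ∷ []) _ _ = s≤s z≤n
proposition8 d H hid (_ ∷ _ ∷ []) _ _ = s≤s (s≤s z≤n)
proposition8 d H hid (_ ∷ _ ∷ _ ∷ []) _ _ = s≤s (s≤s (s≤s z≤n))
proposition8 d H hid (_ ∷ _ ∷ _ ∷ _ ∷ _)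
  ((a≢b ∷ a≢c ∷ a≢e ∷ _) ∷ (b≢c ∷ b≢e ∷ _) ∷ (c≢e ∷ _) ∷ _) (ha ∷ hb ∷ hc ∷ he ∷ _) =
  ⊥-elim (SimplexHiding.no-four-hidden H hid ha hb hc he a≢b a≢c a≢e b≢c b≢e c≢e)
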